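{- For $n \geq 1$, let $d_{e}(n)$ be the number of partitions of $n$ in which exactly one even part is repeated (every other even part appears at most once) and odd parts appear with unrestricted multiplicity; let $d_{o}(n)$ be the number of partitions of $n$ in which exactly one odd part is repeated (every other odd part appears at most once) and even parts appear with unrestricted multiplicity. For $i \in \{0,2\}$, let $f_{i}(n)$ be the number of partitions of $n$ in which the set of (distinct values of) parts congruent to $i \pmod{4}$ has exactly one element. Then for all $n \geq 1$, $$d_{e}(n) = f_{0}(n) \quad\text{and}\quad d_{o}(n) = f_{2}(n).$$
   Context: A part is "repeated" if it appears at least twice. -}

module Defs where

open import Data.Nat using (ℕ; _<_; _≤?_; _≟_; _%_)
open import Data.Nat.Base using (_≥_)
open import Data.List using (List; length; filter; deduplicate)
open import Data.Nat.ListAction using (sum)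
open import Data.List.Relation.Unary.All using (All)
open import Data.List.Relation.Unary.Linked using (Linked)
open import Data.Product using (Σ)
open import Relation.Nullary.Decidable using (_×-dec_)
open import Relation.Binary.PropositionalEquality using (_≡_)

record Partition (n : ℕ) : Set where
  constructor mkPartition
  field
    parts    : List ℕ
    decr     : Linked _≥_ parts
    positive : All (0 <_) parts
    sums     : sum parts ≡ n
open Partition public

mult : ℕ → List ℕ → ℕ
mult k ps = length (filter (k ≟_) ps)

distinctParts : List ℕ → List ℕ
distinctParts ps = deduplicate _≟_ ps

#repeatedEven : List ℕ → ℕ
#repeatedEven ps = length (filter (λ k → (k % 2 ≟ 0) ×-dec (2 ≤? mult k ps)) (distinctParts ps))

#repeatedOdd : List ℕ → ℕ
#repeatedOdd ps = length (filter (λ k → (k % 2 ≟ 1) ×-dec (2 ≤? mult k ps)) (distinctParts ps))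

#partsMod4 : ℕ → List ℕ → ℕ
#partsMod4 i ps = length (filter (λ k → k % 4 ≟ i) (distinctParts ps))

De : ℕ → Set
De n = Σ (Partition n) (λ p → #repeatedEven (parts p) ≡ 1)

Do : ℕ → Set
Do n = Σ (Partition n) (λ p → #repeatedOdd (parts p) ≡ 1)

F : ℕ → ℕ → Set
F i n = Σ (Partition n) (λ p → #partsMod4 i (parts p) ≡ 1)

-- A part w ≥ 1 occurring a times next to the part 2w occurring b times can be traded: merge pairs
-- of w's into 2w's and split every 2w into two w's, i.e. (a, b) ↦ (a mod 2 + 2b, ⌊a/2⌋). The trade
-- preserves the sum, is an involution, and w is repeated before it exactly when 2w occurs after it.
-- Trade at w = 2n, 2n − 2, …, 2 in turn and count, at each stage, the untraded even values that are
-- repeated plus the doubles of traded values that occur: each trade is a bijection preserving this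
-- count, which starts as the number of repeated even parts and ends as the number of distinct parts
-- divisible by 4. Trading at w = 2n − 1, …, 3, 1 likewise turns repeated odd parts into parts
-- congruent to 2 modulo 4.
module Submission where

open import Defs
open import Data.Nat using (ℕ; _≤_)
open import Data.Product using (_×_)
open import Function.Bundles using (_↔_)

open import Data.Nat.Base using (zero; suc; _+_; _*_; _<_; _≥_; _>_; _/_; _%_; z≤n; s≤s; NonZero)
open import Data.Nat using (_≟_; _≤?_)
open import Data.Nat.Properties
open import Data.Nat.DivMod
  using (m≡m%n+[m/n]*n; [m+kn]%n≡m%n; m%n%n≡m%n; m*n%n≡0; m%n<n; m<n⇒m/n≡0; m*n/n≡m;
         +-distrib-/-∣ʳ; m≥n⇒m/n>0; m/n≢0⇒n≤m)
open import Data.Nat.Divisibility using (divides-refl)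
open import Data.Nat.ListAction using (sum)
open import Data.Nat.ListAction.Properties using (sum-++; sum-↭)
open import Data.Nat.Tactic.RingSolver using (solve-∀)
open import Data.List.Base
  using (List; []; _∷_; _++_; _ʳ++_; length; filter; replicate; map; reverse; applyDownFrom; deduplicate)
open import Data.List.Properties
  using (length-++; length-replicate; filter-++; filter-all; filter-none; filter-some;
         filter-accept; filter-reject)
open import Data.List.Membership.Propositional using (_∈_)
open import Data.List.Membership.Propositional.Properties
  using (∈-filter⁺; ∈-filter⁻; ∈-deduplicate⁺; ∈-deduplicate⁻; ∈-map⁺; ∈-map⁻;
         ∈-applyDownFrom⁺; ∈-applyDownFrom⁻)
open import Data.List.Membership.Propositional.Properties.WithK using (unique∧set⇒bag)
open import Data.List.Relation.Binary.BagAndSetEquality using (∼bag⇒↭)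
open import Data.List.Relation.Binary.Permutation.Propositional using (_↭_; prep; ↭-refl; ↭-sym; ↭-trans)
open import Data.List.Relation.Binary.Permutation.Propositional.Properties
  using (↭-length; filter-↭; ++⁺ˡ; shift; All-resp-↭; ↭-reverse)
open import Data.List.Relation.Unary.Any using (here; there)
open import Data.List.Relation.Unary.All using (All; []; _∷_)
import Data.List.Relation.Unary.All as All
import Data.List.Relation.Unary.All.Properties as All
open import Data.List.Relation.Unary.AllPairs using (AllPairs; []; _∷_)
import Data.List.Relation.Unary.AllPairs as AllPairs
import Data.List.Relation.Unary.AllPairs.Properties as AllPairs
import Data.List.Relation.Unary.Linked as Linked
open import Data.List.Relation.Unary.Linked using (Linked)
open import Data.List.Relation.Unary.Linked.Properties using (Linked⇒AllPairs)
open import Data.List.Relation.Unary.Unique.Propositional using (Unique)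
import Data.List.Relation.Unary.Unique.Propositional.Properties as Unique
open import Data.List.Relation.Unary.Unique.DecPropositional.Properties _≟_ using (deduplicate-!)
import Relation.Binary.Construct.Flip.Ord as Flip
open import Data.List.Sort (Flip.decTotalOrder ≤-decTotalOrder) using (sort; sort-↗; sort-↭)
open import Data.Product using (Σ; _,_; proj₁; proj₂)
open import Data.Product.Properties using (Σ-≡,≡→≡)
open import Function.Base using (id)
open import Function.Bundles using (_⇔_; mk↔ₛ′; mk⇔)
open import Function.Properties.Inverse using (↔-refl; ↔-trans)
open import Relation.Nullary using (¬_; ¬?; yes; no; contradiction)
open import Relation.Nullary.Decidable using (_×-dec_)
open import Relation.Unary using (Pred; Decidable)
open import Relation.Binary.PropositionalEquality

mult-++ : ∀ k xs ys → mult k (xs ++ ys) ≡ mult k xs + mult k ys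
mult-++ k xs ys = trans (cong length (filter-++ (k ≟_) xs ys)) (length-++ (filter (k ≟_) xs))

mult-↭ : ∀ k {xs ys} → xs ↭ ys → mult k xs ≡ mult k ys
mult-↭ k xs↭ys = ↭-length (filter-↭ (k ≟_) xs↭ys)

mult-replicate-self : ∀ m x → mult x (replicate m x) ≡ m
mult-replicate-self m x = trans (cong length (filter-all (x ≟_) (All.replicate⁺ m refl))) (length-replicate m)

mult-replicate-other : ∀ {k x} m → k ≢ x → mult k (replicate m x) ≡ 0
mult-replicate-other {k} m k≢x = cong length (filter-none (k ≟_) (All.replicate⁺ m k≢x))

mult-∷-self : ∀ x l → mult x (x ∷ l) ≡ suc (mult x l)
mult-∷-self x l = cong length (filter-accept (x ≟_) refl)

mult-∷-other : ∀ {k x} l → k ≢ x → mult k (x ∷ l) ≡ mult k l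
mult-∷-other {k} l k≢x = cong length (filter-reject (k ≟_) k≢x)

∈⇒1≤mult : ∀ {v l} → v ∈ l → 1 ≤ mult v l
∈⇒1≤mult {v} = filter-some (v ≟_)

1≤mult⇒∈ : ∀ {v} l → 1 ≤ mult v l → v ∈ l
1≤mult⇒∈ {v} (x ∷ l) 1≤m with v ≟ x
... | yes refl = here refl
... | no v≢x = there (1≤mult⇒∈ l (subst (1 ≤_) (mult-∷-other l v≢x) 1≤m))

module _ {p} {P : Pred ℕ p} (P? : Decidable P) where

  mult-filter-kept : ∀ {k} l → P k → mult k (filter P? l) ≡ mult k l
  mult-filter-kept [] _ = refl
  mult-filter-kept {k} (x ∷ l) Pk with P? x | k ≟ x
  ... | yes _ | yes refl =
    trans (mult-∷-self k _) (trans (cong suc (mult-filter-kept l Pk)) (sym (mult-∷-self k l)))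
  ... | yes _ | no k≢x =
    trans (mult-∷-other _ k≢x) (trans (mult-filter-kept l Pk) (sym (mult-∷-other l k≢x)))
  ... | no ¬Px | yes refl = contradiction Pk ¬Px
  ... | no _ | no k≢x = trans (mult-filter-kept l Pk) (sym (mult-∷-other l k≢x))

  mult-filter-dropped : ∀ {k} l → ¬ P k → mult k (filter P? l) ≡ 0
  mult-filter-dropped [] _ = refl
  mult-filter-dropped {k} (x ∷ l) ¬Pk with P? x | k ≟ x
  ... | yes Px | yes refl = contradiction Px ¬Pk
  ... | yes _ | no k≢x = trans (mult-∷-other _ k≢x) (mult-filter-dropped l ¬Pk)
  ... | no _ | _ = mult-filter-dropped l ¬Pk

mult-≗⇒∈ : ∀ {xs ys v} → (∀ k → mult k xs ≡ mult k ys) → v ∈ xs → v ∈ ys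
mult-≗⇒∈ {ys = ys} {v} same v∈xs = 1≤mult⇒∈ ys (subst (1 ≤_) (same v) (∈⇒1≤mult v∈xs))

sorted-head-max : ∀ {x xs v} → Linked _≥_ (x ∷ xs) → v ∈ x ∷ xs → v ≤ x
sorted-head-max _ (here refl) = ≤-refl
sorted-head-max sorted (there v∈xs) with Linked⇒AllPairs (λ i≥j j≥k → ≤-trans j≥k i≥j) sorted
... | x≥xs ∷ _ = All.lookup x≥xs v∈xs

sorted-mult-injective : ∀ {xs ys} → Linked _≥_ xs → Linked _≥_ ys →
                        (∀ k → mult k xs ≡ mult k ys) → xs ≡ ys
sorted-mult-injective {[]} {[]} _ _ _ = refl
sorted-mult-injective {[]} {y ∷ _} _ _ same
  with mult-≗⇒∈ {ys = []} (λ k → sym (same k)) (here {x = y} refl)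
... | ()
sorted-mult-injective {x ∷ _} {[]} _ _ same with mult-≗⇒∈ {ys = []} same (here {x = x} refl)
... | ()
sorted-mult-injective {x ∷ xs} {y ∷ ys} sx sy same
  with ≤-antisym (sorted-head-max sy (mult-≗⇒∈ same (here refl)))
                 (sorted-head-max sx (mult-≗⇒∈ (λ k → sym (same k)) (here refl)))
... | refl = cong (x ∷_) (sorted-mult-injective (Linked.tail sx) (Linked.tail sy) same-tail)
  where
  same-tail : ∀ k → mult k xs ≡ mult k ys
  same-tail k = +-cancelˡ-≡ (mult k (x ∷ [])) _ _
    (trans (sym (mult-++ k (x ∷ []) xs)) (trans (same k) (mult-++ k (x ∷ []) ys)))

-- The exchange of parts w and 2w

without : ℕ → List ℕ → List ℕ
without x = filter (λ v → ¬? (x ≟ v))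

↭-replicate-without : ∀ x l → l ↭ replicate (mult x l) x ++ without x l
↭-replicate-without x [] = ↭-refl
↭-replicate-without x (y ∷ l) with x ≟ y
... | yes refl rewrite mult-∷-self x l | filter-reject (λ v → ¬? (x ≟ v)) {x} {l} (λ x≢x → x≢x refl) =
  prep x (↭-replicate-without x l)
... | no x≢y rewrite mult-∷-other l x≢y | filter-accept (λ v → ¬? (x ≟ v)) {y} {l} x≢y =
  ↭-trans (prep y (↭-replicate-without x l)) (↭-sym (shift y (replicate (mult x l) x) (without x l)))

rest : ℕ → List ℕ → List ℕ
rest w l = without (2 * w) (without w l)

multPair : ℕ → List ℕ → ℕ × ℕ
multPair w l = mult w l , mult (2 * w) l

rebuild : ℕ → ℕ × ℕ → List ℕ → List ℕ
rebuild w (a , b) l = sort (replicate a w ++ replicate b (2 * w) ++ rest w l)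

weight : ℕ → ℕ × ℕ → ℕ
weight w (a , b) = a * w + b * (2 * w)

sum-replicate : ∀ m x → sum (replicate m x) ≡ m * x
sum-replicate zero x = refl
sum-replicate (suc m) x = cong (x +_) (sum-replicate m x)

sum-layout : ∀ w a b r → sum (replicate a w ++ replicate b (2 * w) ++ r) ≡ weight w (a , b) + sum r
sum-layout w a b r = begin
  sum (replicate a w ++ replicate b (2 * w) ++ r)
    ≡⟨ sum-++ (replicate a w) _ ⟩
  sum (replicate a w) + sum (replicate b (2 * w) ++ r)
    ≡⟨ cong₂ _+_ (sum-replicate a w) (trans (sum-++ (replicate b _) r) (cong (_+ sum r) (sum-replicate b _))) ⟩
  a * w + (b * (2 * w) + sum r)
    ≡⟨ +-assoc (a * w) _ _ ⟨
  weight w (a , b) + sum r ∎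
  where open ≡-Reasoning

mult-rebuild : ∀ k w a b l →
  mult k (rebuild w (a , b) l) ≡ mult k (replicate a w) + (mult k (replicate b (2 * w)) + mult k (rest w l))
mult-rebuild k w a b l =
  trans (mult-↭ k (sort-↭ _)) (trans (mult-++ k (replicate a w) _) (cong (_ +_) (mult-++ k (replicate b _) _)))

sum-rebuild : ∀ w c l → sum (rebuild w c l) ≡ weight w c + sum (rest w l)
sum-rebuild w (a , b) l = trans (sum-↭ (sort-↭ _)) (sum-layout w a b (rest w l))

All-rebuild : ∀ {p} {P : Pred ℕ p} {w} c {l} → P w → P (2 * w) → All P l → All P (rebuild w c l)
All-rebuild (a , b) Pw P2w Pl = All-resp-↭ (↭-sym (sort-↭ _))
  (All.++⁺ (All.replicate⁺ a Pw) (All.++⁺ (All.replicate⁺ b P2w) (All.filter⁺ _ (All.filter⁺ _ Pl))))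

module _ {w : ℕ} (w≥1 : 1 ≤ w) where

  w≢2w : w ≢ 2 * w
  w≢2w = <⇒≢ (m<m+n w (≤-trans w≥1 (≤-reflexive (sym (+-identityʳ w)))))

  mult-rest-self : ∀ l → mult w (rest w l) ≡ 0
  mult-rest-self l = trans (mult-filter-kept _ (without w l) (λ 2w≡w → w≢2w (sym 2w≡w)))
                           (mult-filter-dropped _ l (λ w≢w → w≢w refl))

  mult-rest-double : ∀ l → mult (2 * w) (rest w l) ≡ 0
  mult-rest-double l = mult-filter-dropped _ (without w l) (λ 2w≢2w → 2w≢2w refl)

  mult-rest-other : ∀ {k} l → k ≢ w → k ≢ 2 * w → mult k (rest w l) ≡ mult k l
  mult-rest-other l k≢w k≢2w = trans (mult-filter-kept _ (without w l) (λ 2w≡k → k≢2w (sym 2w≡k)))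
                                     (mult-filter-kept _ l (λ w≡k → k≢w (sym w≡k)))

  ↭-layout : ∀ l → l ↭ replicate (mult w l) w ++ replicate (mult (2 * w) l) (2 * w) ++ rest w l
  ↭-layout l = ↭-trans (↭-replicate-without w l) (++⁺ˡ (replicate (mult w l) w)
    (subst (λ m → without w l ↭ replicate m (2 * w) ++ rest w l)
           (mult-filter-kept _ l w≢2w) (↭-replicate-without (2 * w) (without w l))))

  sum-by-layout : ∀ l → sum l ≡ weight w (multPair w l) + sum (rest w l)
  sum-by-layout l = trans (sum-↭ (↭-layout l)) (sum-layout w (mult w l) (mult (2 * w) l) (rest w l))

  multPair-rebuild : ∀ c l → multPair w (rebuild w c l) ≡ c
  multPair-rebuild (a , b) l = cong₂ _,_
    (trans (mult-rebuild w w a b l) (trans (cong₂ _+_ (mult-replicate-self a w)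
      (cong₂ _+_ (mult-replicate-other b w≢2w) (mult-rest-self l))) (+-identityʳ a)))
    (trans (mult-rebuild (2 * w) w a b l) (trans (cong₂ _+_ (mult-replicate-other a (λ 2w≡w → w≢2w (sym 2w≡w)))
      (cong₂ _+_ (mult-replicate-self b (2 * w)) (mult-rest-double l))) (+-identityʳ b)))

  mult-rebuild-other : ∀ {k} c l → k ≢ w → k ≢ 2 * w → mult k (rebuild w c l) ≡ mult k l
  mult-rebuild-other {k} (a , b) l k≢w k≢2w = trans (mult-rebuild k w a b l)
    (trans (cong₂ _+_ (mult-replicate-other a k≢w) (cong₂ _+_ (mult-replicate-other b k≢2w) refl))
           (mult-rest-other l k≢w k≢2w))

exchangeCounts : ℕ × ℕ → ℕ × ℕ
exchangeCounts (a , b) = a % 2 + b * 2 , a / 2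

exchangeCounts-involutive : ∀ c → exchangeCounts (exchangeCounts c) ≡ c
exchangeCounts-involutive (a , b) = cong₂ _,_ first second
  where
  first : (a % 2 + b * 2) % 2 + a / 2 * 2 ≡ a
  first = trans (cong (_+ a / 2 * 2) (trans ([m+kn]%n≡m%n (a % 2) b 2) (m%n%n≡m%n a 2)))
                (sym (m≡m%n+[m/n]*n a 2))
  second : (a % 2 + b * 2) / 2 ≡ b
  second = trans (+-distrib-/-∣ʳ (a % 2) (divides-refl b))
                 (cong₂ _+_ (m<n⇒m/n≡0 (m%n<n a 2)) (m*n/n≡m b 2))

weight-exchangeCounts : ∀ w c → weight w (exchangeCounts c) ≡ weight w c
weight-exchangeCounts w (a , b) =
  trans (regroup (a % 2) (a / 2) b w) (cong (λ x → x * w + b * (2 * w)) (sym (m≡m%n+[m/n]*n a 2)))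
  where
  regroup : ∀ r q b w → (r + b * 2) * w + q * (2 * w) ≡ (r + q * 2) * w + b * (2 * w)
  regroup = solve-∀

exchange : ℕ → List ℕ → List ℕ
exchange w l = rebuild w (exchangeCounts (multPair w l)) l

module _ {w : ℕ} (w≥1 : 1 ≤ w) where

  multPair-exchange : ∀ l → multPair w (exchange w l) ≡ exchangeCounts (multPair w l)
  multPair-exchange l = multPair-rebuild w≥1 (exchangeCounts (multPair w l)) l

  mult-exchange-other : ∀ {k} l → k ≢ w → k ≢ 2 * w → mult k (exchange w l) ≡ mult k l
  mult-exchange-other l = mult-rebuild-other w≥1 (exchangeCounts (multPair w l)) l

  sum-exchange : ∀ l → sum (exchange w l) ≡ sum l
  sum-exchange l = trans (sum-rebuild w (exchangeCounts (multPair w l)) l)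
    (trans (cong (_+ sum (rest w l)) (weight-exchangeCounts w (multPair w l))) (sym (sum-by-layout w≥1 l)))

  exchange-involutive : ∀ {l} → Linked _≥_ l → exchange w (exchange w l) ≡ l
  exchange-involutive {l} sorted = sorted-mult-injective (sort-↗ _) sorted same
    where
    pair : multPair w (exchange w (exchange w l)) ≡ multPair w l
    pair = trans (multPair-exchange (exchange w l))
      (trans (cong exchangeCounts (multPair-exchange l)) (exchangeCounts-involutive (multPair w l)))
    same : ∀ k → mult k (exchange w (exchange w l)) ≡ mult k l
    same k with k ≟ w | k ≟ 2 * w
    ... | yes refl | _ = cong proj₁ pair
    ... | no _ | yes refl = cong proj₂ pair
    ... | no k≢w | no k≢2w = trans (mult-exchange-other (exchange w l) k≢w k≢2w) (mult-exchange-other l k≢w k≢2w)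

Partition-≡ : ∀ {n} {p q : Partition n} → parts p ≡ parts q → p ≡ q
Partition-≡ {p = mkPartition _ d a s} {mkPartition _ d′ a′ s′} refl
  rewrite Linked.irrelevant ≤-irrelevant d d′ | All.irrelevant ≤-irrelevant a a′ | ≡-irrelevant s s′ = refl

exchangeᴾ : ∀ {n w} → 1 ≤ w → Partition n → Partition n
exchangeᴾ {w = w} w≥1 p = mkPartition (exchange w (parts p)) (sort-↗ _)
  (All-rebuild (exchangeCounts (multPair w (parts p))) w≥1 (≤-trans w≥1 (m≤m+n w (w + 0))) (positive p))
  (trans (sum-exchange w≥1 (parts p)) (sums p))

exchangeᴾ-involutive : ∀ {n w} (w≥1 : 1 ≤ w) (p : Partition n) → exchangeᴾ w≥1 (exchangeᴾ w≥1 p) ≡ p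
exchangeᴾ-involutive w≥1 p = Partition-≡ (exchange-involutive w≥1 (decr p))

-- Interpolating statistics

Stat≡1 : (List ℕ → ℕ) → ℕ → Set
Stat≡1 f n = Σ (Partition n) (λ p → f (parts p) ≡ 1)

Stat≡1-↔ : ∀ {n} {f g : List ℕ → ℕ} (σ : Partition n → Partition n) → (∀ p → σ (σ p) ≡ p) →
           (∀ p → g (parts (σ p)) ≡ f (parts p)) → Stat≡1 f n ↔ Stat≡1 g n
Stat≡1-↔ {n} {f} {g} σ σσ≡id g∘σ≡f = mk↔ₛ′ to from (λ (q , _) → Σ-≡ (σσ≡id q)) (λ (p , _) → Σ-≡ (σσ≡id p))
  where
  Σ-≡ : ∀ {h : List ℕ → ℕ} {p q : Partition n} {e : h (parts p) ≡ 1} {e′ : h (parts q) ≡ 1} →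
        p ≡ q → _≡_ {A = Stat≡1 h n} (p , e) (q , e′)
  Σ-≡ p≡q = Σ-≡,≡→≡ (p≡q , ≡-irrelevant _ _)
  to : Stat≡1 f n → Stat≡1 g n
  to (p , e) = σ p , trans (g∘σ≡f p) e
  from : Stat≡1 g n → Stat≡1 f n
  from (q , e) = σ q , trans (sym (g∘σ≡f (σ q))) (trans (cong (λ r → g (parts r)) (σσ≡id q)) e)

Stat≡1-cong : ∀ {n} {f g : List ℕ → ℕ} → (∀ (p : Partition n) → f (parts p) ≡ g (parts p)) →
              Stat≡1 f n ↔ Stat≡1 g n
Stat≡1-cong f≗g = Stat≡1-↔ id (λ _ → refl) (λ p → sym (f≗g p))

#occurring : ℕ → List ℕ → List ℕ → ℕ
#occurring k vs l = length (filter (λ v → k ≤? mult v l) vs)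

#mixed : List ℕ → List ℕ → List ℕ → ℕ
#mixed R P l = #occurring 2 R l + #occurring 1 P l

#occurring-accept : ∀ {k v} vs l → k ≤ mult v l → #occurring k (v ∷ vs) l ≡ suc (#occurring k vs l)
#occurring-accept {k} vs l k≤m = cong length (filter-accept (λ v → k ≤? mult v l) {xs = vs} k≤m)

#occurring-reject : ∀ {k v} vs l → ¬ k ≤ mult v l → #occurring k (v ∷ vs) l ≡ #occurring k vs l
#occurring-reject {k} vs l k≰m = cong length (filter-reject (λ v → k ≤? mult v l) {xs = vs} k≰m)

#occurring-∷ : ∀ k v vs l → #occurring k (v ∷ vs) l ≡ #occurring k (v ∷ []) l + #occurring k vs l
#occurring-∷ k v vs l =
  trans (cong length (filter-++ occurs? (v ∷ []) vs)) (length-++ (filter occurs? (v ∷ [])))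
  where occurs? = λ u → k ≤? mult u l

#occurring-singleton : ∀ k v l k′ v′ l′ →
                       (k ≤ mult v l → k′ ≤ mult v′ l′) → (k′ ≤ mult v′ l′ → k ≤ mult v l) →
                       #occurring k (v ∷ []) l ≡ #occurring k′ (v′ ∷ []) l′
#occurring-singleton k v l k′ v′ l′ to from with k ≤? mult v l | k′ ≤? mult v′ l′
... | yes p | yes q = trans (#occurring-accept [] l p) (sym (#occurring-accept [] l′ q))
... | no ¬p | no ¬q = trans (#occurring-reject [] l ¬p) (sym (#occurring-reject [] l′ ¬q))
... | yes p | no ¬q = contradiction (to p) ¬q
... | no ¬p | yes q = contradiction (from q) ¬p

#occurring-cong : ∀ k {vs} l l′ → All (λ v → mult v l ≡ mult v l′) vs →
                  #occurring k vs l ≡ #occurring k vs l′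
#occurring-cong k l l′ [] = refl
#occurring-cong k {v ∷ vs} l l′ (e ∷ es) = begin
  #occurring k (v ∷ vs) l
    ≡⟨ #occurring-∷ k v vs l ⟩
  #occurring k (v ∷ []) l + #occurring k vs l
    ≡⟨ cong₂ _+_ (#occurring-singleton k v l k v l′ (subst (k ≤_) e) (subst (k ≤_) (sym e)))
                 (#occurring-cong k l l′ es) ⟩
  #occurring k (v ∷ []) l′ + #occurring k vs l′
    ≡⟨ #occurring-∷ k v vs l′ ⟨
  #occurring k (v ∷ vs) l′ ∎
  where open ≡-Reasoning

#occurring-↭ : ∀ k {vs vs′} l → vs ↭ vs′ → #occurring k vs l ≡ #occurring k vs′ l
#occurring-↭ k l vs↭vs′ = ↭-length (filter-↭ (λ v → k ≤? mult v l) vs↭vs′)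

Unmoved : ℕ → ℕ → Set
Unmoved w v = v ≢ w × v ≢ 2 * w

-- A repeated w before the exchange is the same as a present 2w after it.
#mixed-exchange : ∀ {w} R P l → 1 ≤ w → All (Unmoved w) R → All (Unmoved w) P →
                  #mixed R (2 * w ∷ P) (exchange w l) ≡ #mixed (w ∷ R) P l
#mixed-exchange {w} R P l w≥1 unmovedR unmovedP = begin
  #occurring 2 R l′ + #occurring 1 (2 * w ∷ P) l′
    ≡⟨ cong (#occurring 2 R l′ +_) (#occurring-∷ 1 (2 * w) P l′) ⟩
  #occurring 2 R l′ + (#occurring 1 (2 * w ∷ []) l′ + #occurring 1 P l′)
    ≡⟨ cong₂ _+_ (#occurring-cong 2 l′ l (unchanged unmovedR))
                 (cong₂ _+_ (#occurring-singleton 1 (2 * w) l′ 2 w l half≥1⇒ ⇒half≥1)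
                            (#occurring-cong 1 l′ l (unchanged unmovedP))) ⟩
  #occurring 2 R l + (#occurring 2 (w ∷ []) l + #occurring 1 P l)
    ≡⟨ +-assoc (#occurring 2 R l) _ _ ⟨
  #occurring 2 R l + #occurring 2 (w ∷ []) l + #occurring 1 P l
    ≡⟨ cong (_+ #occurring 1 P l) (trans (+-comm (#occurring 2 R l) _) (sym (#occurring-∷ 2 w R l))) ⟩
  #occurring 2 (w ∷ R) l + #occurring 1 P l ∎
  where
  open ≡-Reasoning
  l′ = exchange w l
  unchanged : ∀ {vs} → All (Unmoved w) vs → All (λ v → mult v l′ ≡ mult v l) vs
  unchanged = All.map (λ (≢w , ≢2w) → mult-exchange-other w≥1 l ≢w ≢2w)
  half : mult (2 * w) l′ ≡ mult w l / 2
  half = cong proj₂ (multPair-exchange w≥1 l)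
  half≥1⇒ : 1 ≤ mult (2 * w) l′ → 2 ≤ mult w l
  half≥1⇒ 1≤h = m/n≢0⇒n≤m (λ a/2≡0 → <⇒≢ 1≤h (sym (trans half a/2≡0)))
  ⇒half≥1 : 2 ≤ mult w l → 1 ≤ mult (2 * w) l′
  ⇒half≥1 2≤a = subst (1 ≤_) (sym half) (m≥n⇒m/n>0 2≤a)

-- Taking the values of ws in decreasing order keeps every exchange away from the values already moved.
#mixed-chain : ∀ {n} ws P → All (1 ≤_) ws → AllPairs _>_ ws → All (λ w → All (2 * w <_) P) ws →
               Stat≡1 (#mixed ws P) n ↔ Stat≡1 (#mixed [] (map (2 *_) ws ʳ++ P)) n
#mixed-chain [] P _ _ _ = ↔-refl
#mixed-chain (w ∷ ws) P (w≥1 ∷ ws≥1) (w>ws ∷ ws↘) (2w<P ∷ 2ws<P) =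
  ↔-trans (Stat≡1-↔ (exchangeᴾ w≥1) (exchangeᴾ-involutive w≥1)
                     (λ p → #mixed-exchange ws P (parts p) w≥1 (All.map below w>ws) (All.map above 2w<P)))
          (#mixed-chain ws (2 * w ∷ P) ws≥1 ws↘
                        (All.zipWith (λ (v<w , 2v<P) → *-monoʳ-< 2 v<w ∷ 2v<P) (w>ws , 2ws<P)))
  where
  below : ∀ {v} → v < w → Unmoved w v
  below v<w = <⇒≢ v<w , <⇒≢ (<-≤-trans v<w (m≤m+n w (w + 0)))
  above : ∀ {v} → 2 * w < v → Unmoved w v
  above 2w<v = >⇒≢ (≤-<-trans (m≤m+n w (w + 0)) 2w<v) , >⇒≢ 2w<v

#mixed-chain-from-repeated : ∀ {n} ws → All (1 ≤_) ws → AllPairs _>_ ws →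
                             Stat≡1 (#mixed ws []) n ↔ Stat≡1 (#mixed [] (reverse (map (2 *_) ws))) n
#mixed-chain-from-repeated ws ws≥1 ws↘ = #mixed-chain ws [] ws≥1 ws↘ (All.tabulate (λ _ → []))

unique-length : ∀ {xs ys : List ℕ} → Unique xs → Unique ys → (∀ {v} → v ∈ xs ⇔ v ∈ ys) →
                length xs ≡ length ys
unique-length xs! ys! same = ↭-length (∼bag⇒↭ (unique∧set⇒bag xs! ys! same))

distinct-count : ∀ {q} {Q : Pred ℕ q} (Q? : Decidable Q) k l {U} → 1 ≤ k → Unique U →
                 (∀ {v} → v ∈ l → Q v → v ∈ U × k ≤ mult v l) → (∀ {v} → v ∈ U → k ≤ mult v l → Q v) →
                 length (filter Q? (deduplicate _≟_ l)) ≡ #occurring k U l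
distinct-count Q? k l {U} k≥1 U! into back =
  unique-length (Unique.filter⁺ Q? (deduplicate-! l)) (Unique.filter⁺ occurs? U!) (mk⇔ to from)
  where
  occurs? : Decidable (λ v → k ≤ mult v l)
  occurs? v = k ≤? mult v l
  to : ∀ {v} → v ∈ filter Q? (deduplicate _≟_ l) → v ∈ filter occurs? U
  to v∈ with ∈-filter⁻ Q? v∈
  ... | v∈dedup , Qv with into (∈-deduplicate⁻ _≟_ l v∈dedup) Qv
  ... | v∈U , k≤m = ∈-filter⁺ occurs? v∈U k≤m
  from : ∀ {v} → v ∈ filter occurs? U → v ∈ filter Q? (deduplicate _≟_ l)
  from v∈ with ∈-filter⁻ occurs? v∈
  ... | v∈U , k≤m = ∈-filter⁺ Q? (∈-deduplicate⁺ _≟_ (1≤mult⇒∈ l (≤-trans k≥1 k≤m))) (back v∈U k≤m)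

∈⇒≤sum : ∀ {v l} → v ∈ l → v ≤ sum l
∈⇒≤sum {l = x ∷ l} (here refl) = m≤m+n x (sum l)
∈⇒≤sum {l = x ∷ l} (there v∈l) = ≤-trans (∈⇒≤sum v∈l) (m≤n+m (sum l) x)

∈-parts-positive : ∀ {n v} (p : Partition n) → v ∈ parts p → 1 ≤ v
∈-parts-positive p = All.lookup (positive p)

∈-parts-≤ : ∀ {n v} (p : Partition n) → v ∈ parts p → v ≤ n
∈-parts-≤ p v∈ = subst (_ ≤_) (sums p) (∈⇒≤sum v∈)

%≡⇒≡ : ∀ {m n r} .{{_ : NonZero n}} → m % n ≡ r → m ≡ r + m / n * n
%≡⇒≡ {m} {n} m%n≡r = trans (m≡m%n+[m/n]*n m n) (cong (_+ m / n * n) m%n≡r)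

∈-applyDownFrom-≤ : ∀ f {k n} → suc k ≤ f k → f k ≤ n → f k ∈ applyDownFrom f n
∈-applyDownFrom-≤ f k<fk fk≤n = ∈-applyDownFrom⁺ f (≤-trans k<fk fk≤n)

applyDownFrom-decreasing : ∀ f → (∀ {i j} → i < j → f i < f j) → ∀ n → AllPairs _>_ (applyDownFrom f n)
applyDownFrom-decreasing f f-mono n = AllPairs.applyDownFrom⁺₁ f n (λ j<i _ → f-mono j<i)

decreasing⇒unique : ∀ {xs} → AllPairs _>_ xs → Unique xs
decreasing⇒unique = AllPairs.map >⇒≢

double-unique : ∀ {xs} → Unique xs → Unique (map (2 *_) xs)
double-unique = Unique.map⁺ (λ {x} {y} → *-cancelˡ-≡ x y 2)

evens : ℕ → List ℕ
evens n = applyDownFrom (λ k → suc k * 2) n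

evens-positive : ∀ n → All (1 ≤_) (evens n)
evens-positive n = All.applyDownFrom⁺₁ _ n (λ _ → s≤s z≤n)

evens-decreasing : ∀ n → AllPairs _>_ (evens n)
evens-decreasing = applyDownFrom-decreasing _ (λ i<j → *-monoˡ-< 2 (s≤s i<j))

even-∈-evens : ∀ {n v} → 1 ≤ v → v ≤ n → v % 2 ≡ 0 → v ∈ evens n
even-∈-evens {n} {v} v≥1 v≤n v%2≡0 with v / 2 | %≡⇒≡ {v} {2} v%2≡0
... | zero | v≡0 = contradiction (sym v≡0) (<⇒≢ v≥1)
... | suc k | refl = ∈-applyDownFrom-≤ _ (m≤m*n (suc k) 2) v≤n

∈-evens⇒even : ∀ {n v} → v ∈ evens n → v % 2 ≡ 0
∈-evens⇒even v∈ with ∈-applyDownFrom⁻ _ v∈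
... | k , _ , refl = m*n%n≡0 (suc k) 2

quad-∈-doubled-evens : ∀ {n v} → 1 ≤ v → v ≤ n → v % 4 ≡ 0 → v ∈ map (2 *_) (evens n)
quad-∈-doubled-evens {n} {v} v≥1 v≤n v%4≡0 with v / 4 | %≡⇒≡ {v} {4} v%4≡0
... | zero | v≡0 = contradiction (sym v≡0) (<⇒≢ v≥1)
... | suc k | refl = subst (_∈ map (2 *_) (evens n)) (sym (quadruple k)) (∈-map⁺ (2 *_) half∈evens)
  where
  quadruple : ∀ k → suc k * 4 ≡ 2 * (suc k * 2)
  quadruple = solve-∀
  half∈evens : suc k * 2 ∈ evens n
  half∈evens = ∈-applyDownFrom-≤ _ (m≤m*n (suc k) 2)
    (≤-trans (m≤n*m (suc k * 2) 2) (subst (_≤ n) (quadruple k) v≤n))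

∈-doubled-evens⇒quad : ∀ {n v} → v ∈ map (2 *_) (evens n) → v % 4 ≡ 0
∈-doubled-evens⇒quad v∈ with ∈-map⁻ (2 *_) v∈
... | w , w∈ , refl with ∈-applyDownFrom⁻ _ w∈
... | k , _ , refl = trans (cong (_% 4) (quadruple k)) (m*n%n≡0 (suc k) 4)
  where
  quadruple : ∀ k → 2 * (suc k * 2) ≡ suc k * 4
  quadruple = solve-∀

odds : ℕ → List ℕ
odds n = applyDownFrom (λ k → 1 + k * 2) n

odds-positive : ∀ n → All (1 ≤_) (odds n)
odds-positive n = All.applyDownFrom⁺₁ _ n (λ _ → s≤s z≤n)

odds-decreasing : ∀ n → AllPairs _>_ (odds n)
odds-decreasing = applyDownFrom-decreasing _ (λ i<j → s≤s (*-monoˡ-< 2 i<j))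

odd-∈-odds : ∀ {n v} → v ≤ n → v % 2 ≡ 1 → v ∈ odds n
odd-∈-odds {n} {v} v≤n v%2≡1 with v / 2 | %≡⇒≡ {v} {2} v%2≡1
... | k | refl = ∈-applyDownFrom-≤ _ (s≤s (m≤m*n k 2)) v≤n

∈-odds⇒odd : ∀ {n v} → v ∈ odds n → v % 2 ≡ 1
∈-odds⇒odd v∈ with ∈-applyDownFrom⁻ _ v∈
... | k , _ , refl = [m+kn]%n≡m%n 1 k 2

twiceOdd-∈-doubled-odds : ∀ {n v} → v ≤ n → v % 4 ≡ 2 → v ∈ map (2 *_) (odds n)
twiceOdd-∈-doubled-odds {n} {v} v≤n v%4≡2 with v / 4 | %≡⇒≡ {v} {4} v%4≡2
... | k | refl = subst (_∈ map (2 *_) (odds n)) (sym (twiceOdd k)) (∈-map⁺ (2 *_) half∈odds)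
  where
  twiceOdd : ∀ k → 2 + k * 4 ≡ 2 * (1 + k * 2)
  twiceOdd = solve-∀
  half∈odds : 1 + k * 2 ∈ odds n
  half∈odds = ∈-applyDownFrom-≤ _ (s≤s (m≤m*n k 2))
    (≤-trans (m≤n*m (1 + k * 2) 2) (subst (_≤ n) (twiceOdd k) v≤n))

∈-doubled-odds⇒twiceOdd : ∀ {n v} → v ∈ map (2 *_) (odds n) → v % 4 ≡ 2
∈-doubled-odds⇒twiceOdd v∈ with ∈-map⁻ (2 *_) v∈
... | w , w∈ , refl with ∈-applyDownFrom⁻ _ w∈
... | k , _ , refl = trans (cong (_% 4) (twiceOdd k)) ([m+kn]%n≡m%n 2 k 4)
  where
  twiceOdd : ∀ k → 2 * (1 + k * 2) ≡ 2 + k * 4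
  twiceOdd = solve-∀

module _ {n : ℕ} (p : Partition n) where

  #repeatedEven≡#mixed : #repeatedEven (parts p) ≡ #mixed (evens n) [] (parts p)
  #repeatedEven≡#mixed = trans
    (distinct-count (λ k → (k % 2 ≟ 0) ×-dec (2 ≤? mult k (parts p))) 2 (parts p) (s≤s z≤n)
      (decreasing⇒unique (evens-decreasing n))
      (λ v∈ (even , 2≤m) → even-∈-evens (∈-parts-positive p v∈) (∈-parts-≤ p v∈) even , 2≤m)
      (λ v∈ 2≤m → ∈-evens⇒even v∈ , 2≤m))
    (sym (+-identityʳ _))

  #mixed≡#partsMod4-0 : #mixed [] (reverse (map (2 *_) (evens n))) (parts p) ≡ #partsMod4 0 (parts p)
  #mixed≡#partsMod4-0 = trans (#occurring-↭ 1 (parts p) (↭-reverse (map (2 *_) (evens n)))) (sym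
    (distinct-count (λ k → k % 4 ≟ 0) 1 (parts p) ≤-refl
      (double-unique (decreasing⇒unique (evens-decreasing n)))
      (λ v∈ v%4≡0 → quad-∈-doubled-evens (∈-parts-positive p v∈) (∈-parts-≤ p v∈) v%4≡0 , ∈⇒1≤mult v∈)
      (λ v∈ _ → ∈-doubled-evens⇒quad v∈)))

  #repeatedOdd≡#mixed : #repeatedOdd (parts p) ≡ #mixed (odds n) [] (parts p)
  #repeatedOdd≡#mixed = trans
    (distinct-count (λ k → (k % 2 ≟ 1) ×-dec (2 ≤? mult k (parts p))) 2 (parts p) (s≤s z≤n)
      (decreasing⇒unique (odds-decreasing n))
      (λ v∈ (odd , 2≤m) → odd-∈-odds (∈-parts-≤ p v∈) odd , 2≤m)
      (λ v∈ 2≤m → ∈-odds⇒odd v∈ , 2≤m))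
    (sym (+-identityʳ _))

  #mixed≡#partsMod4-2 : #mixed [] (reverse (map (2 *_) (odds n))) (parts p) ≡ #partsMod4 2 (parts p)
  #mixed≡#partsMod4-2 = trans (#occurring-↭ 1 (parts p) (↭-reverse (map (2 *_) (odds n)))) (sym
    (distinct-count (λ k → k % 4 ≟ 2) 1 (parts p) ≤-refl
      (double-unique (decreasing⇒unique (odds-decreasing n)))
      (λ v∈ v%4≡2 → twiceOdd-∈-doubled-odds (∈-parts-≤ p v∈) v%4≡2 , ∈⇒1≤mult v∈)
      (λ v∈ _ → ∈-doubled-odds⇒twiceOdd v∈)))

theorem5 : (n : ℕ) → 1 ≤ n → (De n ↔ F 0 n) × (Do n ↔ F 2 n)
theorem5 n _ =
  ↔-trans (Stat≡1-cong #repeatedEven≡#mixed)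
    (↔-trans (#mixed-chain-from-repeated (evens n) (evens-positive n) (evens-decreasing n))
             (Stat≡1-cong #mixed≡#partsMod4-0)) ,
  ↔-trans (Stat≡1-cong #repeatedOdd≡#mixed)
    (↔-trans (#mixed-chain-from-repeated (odds n) (odds-positive n) (odds-decreasing n))
             (Stat≡1-cong #mixed≡#partsMod4-2))
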